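{- The structure $(\mathbb{Z},<,=)$ has the property $\mathsf{EHomDef}(\mathsf{WMSO{+}B})$.
   Context: Here $(\mathbb{Z},<,=)$ is a structure over the signature $\{<,=\}$ (both binary) with the usual order and equality. For a $\sigma$-structure $\mathcal{B}=(B,J)$ with $\sigma\subseteq\{<,=\}$, a homomorphism to $(\mathbb{Z},<,=)$ is a map $h:B\to\mathbb{Z}$ with $h(b_1)<h(b_2)$ whenever $(b_1,b_2)\in J(<)$ (if $<\in\sigma$) and $h(b_1)=h(b_2)$ whenever $(b_1,b_2)\in J(=)$ (if $=\in\sigma$); note $J(=)$ need not be the identity relation. Write $\mathcal{B}\preceq\mathcal{A}$ if a homomorphism exists. $\mathsf{WMSO}$ is monadic second-order logic with set variables ranging only over finite sets; $\mathsf{WMSO{+}B}$ adds the bounding quantifier: $\mathcal{A}\models\mathsf{B}X\colon\phi(X)$ iff there is $b\in\mathbb{N}$ with $|F|\le b$ for every finite $F$ with $\mathcal{A}\models\phi(F)$. A structure $\mathcal{A}$ over signature $\mathcal{S}$ has property $\mathsf{EHomDef}(\mathcal{L})$ if there is a computable function mapping each finite $\sigma\subseteq\mathcal{S}$ to an $\mathcal{L}$-sentence $\varphi_\sigma$ over $\sigma$ such that for every countable $\sigma$-structure $\mathcal{B}$: $\mathcal{B}\preceq\mathcal{A}$ iff $\mathcal{B}\models\varphi_\sigma$. -}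

module Defs where

open import Data.Bool using (Bool; T)
open import Data.Nat using (ℕ; zero; suc; _≤_)
open import Data.Integer using (ℤ) renaming (_<_ to _<ℤ_)
open import Data.Fin using (Fin)
open import Data.Vec using (Vec; []; _∷_; lookup)
open import Data.List using (List; length)
open import Data.List.Membership.Propositional using (_∈_)
open import Data.List.Relation.Unary.Unique.Propositional using (Unique)
open import Data.Product using (Σ; _×_; proj₁)
open import Data.Sum using (_⊎_)
open import Relation.Nullary using (¬_)
open import Relation.Binary.PropositionalEquality using (_≡_)
open import Function.Bundles using (_⇔_)

data Sym : Set where
  lt eq : Sym

-- A (necessarily finite) subsignature σ ⊆ {<, =}: the characteristic function.
Sig : Set
Sig = Sym → Bool

ZRel : Sym → ℤ → ℤ → Set
ZRel lt = _<ℤ_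
ZRel eq = _≡_

-- Countable σ-structures: a carrier with an injection into ℕ, and a binary
-- relation J(R) for each symbol R ∈ σ (J(=) need not be the identity).
record CStr (σ : Sig) : Set₁ where
  field
    Carrier  : Set
    rel      : (R : Sym) → T (σ R) → Carrier → Carrier → Set
    code     : Carrier → ℕ
    code-inj : ∀ x y → code x ≡ code y → x ≡ y
open CStr public

_⪯ℤ : ∀ {σ} → CStr σ → Set
_⪯ℤ {σ} B = Σ (Carrier B → ℤ) λ h →
  ∀ (R : Sym) (p : T (σ R)) x y → rel B R p x y → ZRel R (h x) (h y)

-- Finite subsets, represented by duplicate-free lists (cardinality = length).
FinSet : Set → Set
FinSet C = Σ (List C) Unique

-- WMSO+B formulas over σ with n free first-order and m free (finite) set
-- variables (de Bruijn indices).
data Formula (σ : Sig) : ℕ → ℕ → Set where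
  atom : ∀ {n m} (R : Sym) → T (σ R) → Fin n → Fin n → Formula σ n m
  eqv  : ∀ {n m} → Fin n → Fin n → Formula σ n m          -- logical equality x = y
  mem  : ∀ {n m} → Fin n → Fin m → Formula σ n m
  neg  : ∀ {n m} → Formula σ n m → Formula σ n m
  and  : ∀ {n m} → Formula σ n m → Formula σ n m → Formula σ n m
  or   : ∀ {n m} → Formula σ n m → Formula σ n m → Formula σ n m
  ex1  : ∀ {n m} → Formula σ (suc n) m → Formula σ n m
  all1 : ∀ {n m} → Formula σ (suc n) m → Formula σ n m
  ex2  : ∀ {n m} → Formula σ n (suc m) → Formula σ n m
  all2 : ∀ {n m} → Formula σ n (suc m) → Formula σ n m
  bnd  : ∀ {n m} → Formula σ n (suc m) → Formula σ n m

Sentence : Sig → Set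
Sentence σ = Formula σ 0 0

Sat : ∀ {σ n m} (B : CStr σ) → Vec (Carrier B) n → Vec (FinSet (Carrier B)) m →
      Formula σ n m → Set
Sat B ρ η (atom R p i j) = rel B R p (lookup ρ i) (lookup ρ j)
Sat B ρ η (eqv i j)     = lookup ρ i ≡ lookup ρ j
Sat B ρ η (mem i k)     = lookup ρ i ∈ proj₁ (lookup η k)
Sat B ρ η (neg φ)       = ¬ Sat B ρ η φ
Sat B ρ η (and φ ψ)     = Sat B ρ η φ × Sat B ρ η ψ
Sat B ρ η (or φ ψ)      = Sat B ρ η φ ⊎ Sat B ρ η ψ
Sat B ρ η (ex1 φ)       = Σ (Carrier B) λ c → Sat B (c ∷ ρ) η φ
Sat B ρ η (all1 φ)      = ∀ c → Sat B (c ∷ ρ) η φ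
Sat B ρ η (ex2 φ)       = Σ (FinSet (Carrier B)) λ F → Sat B ρ (F ∷ η) φ
Sat B ρ η (all2 φ)      = ∀ F → Sat B ρ (F ∷ η) φ
Sat B ρ η (bnd φ)       = Σ ℕ λ b → ∀ F → Sat B ρ (F ∷ η) φ → length (proj₁ F) ≤ b

_⊨_ : ∀ {σ} → CStr σ → Sentence σ → Set
B ⊨ φ = Sat B [] [] φ

-- EHomDef(WMSO+B) for (ℤ,<,=): a (total, hence computable) map σ ↦ φ_σ with
-- B ⪯ ℤ ⇔ B ⊨ φ_σ for every countable σ-structure B.
EHomDef-WMSOB-ℤ : Set₁
EHomDef-WMSOB-ℤ = Σ ((σ : Sig) → Sentence σ) λ φ →
  ∀ (σ : Sig) (B : CStr σ) → (B ⪯ℤ) ⇔ (B ⊨ φ σ)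

-- Read the relations of a σ-structure B as a weighted graph: a <-edge is a step of
-- weight 1 and an =-edge a step of weight 0 that may be crossed in either direction.
-- A map h : B → ℤ is a homomorphism iff it is a potential, h a + n ≤ h b for every
-- walk from a to b of weight n.  A potential exists iff there is no cycle of positive
-- weight and the weights of walks between any two fixed vertices are bounded: given
-- these, an enumeration of B extends a finite potential one vertex at a time, the new
-- value being squeezed between the constraints imposed by heaviest walks to and from
-- the vertices placed so far.  Both conditions are WMSO+B-definable: reachability by
-- walks is the least set closed under steps inside some finite set, and the weights
-- of walks from x to y are bounded iff the finite chains of vertices between x and y,
-- ordered by positive-weight reachability, have bounded size, the targets of the
-- <-steps of a walk forming such a chain.
module Submission where

open import Defs
open import Level using (0ℓ)
open import Axiom.ExcludedMiddle using (ExcludedMiddle)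

open import Algebra.Bundles using (AbelianGroup)
import Algebra.Properties.Group as GroupProperties
open import Data.Bool using (Bool; true; false; T)
open import Data.Empty using (⊥-elim)
open import Data.Fin as Fin using (Fin; #_; _↑ʳ_; toℕ; fromℕ<)
open import Data.Fin.Properties using (toℕ-fromℕ<; injective⇒≤)
open import Data.Integer using (ℤ; +_; +≤+; _+_; _-_; -_; ∣_∣; 0ℤ) renaming (_≤_ to _≤ℤ_; _<_ to _<ℤ_; suc to sucℤ)
import Data.Integer.Properties as ℤ
open import Data.Integer.Tactic.RingSolver using (solve-∀)
open import Data.List using (List; []; _∷_; length; lookup; map; concatMap; filter; deduplicate)
import Data.List.Extrema ℤ.≤-totalOrder as Extrema
open import Data.List.Membership.Propositional using (_∈_; find; lose)
open import Data.List.Membership.Propositional.Properties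
  using (∈-lookup; ∈-map⁺; ∈-map⁻; ∈-concatMap⁺; ∈-concatMap⁻; ∈-filter⁺; ∈-filter⁻; ∈-deduplicate⁺)
open import Data.List.Relation.Binary.Subset.Propositional using (_⊆_)
open import Data.List.Relation.Unary.All as All using (All)
open import Data.List.Relation.Unary.AllPairs as AllPairs using (AllPairs; []; _∷_)
open import Data.List.Relation.Unary.Any using (here; there)
open import Data.List.Relation.Unary.Unique.Propositional using (Unique)
open import Data.List.Relation.Unary.Unique.Propositional.Properties using (filter⁺)
open import Data.List.Relation.Unary.Unique.DecPropositional.Properties using (deduplicate-!)
open import Data.Nat as ℕ using (ℕ; zero; suc; _≤_; _<_; _⊔_; s≤s; _≤′_; ≤′-refl; ≤′-step)
import Data.Nat.Properties as ℕ
open import Data.Product as Product using (Σ; ∃; ∃₂; _×_; _,_; proj₁; proj₂)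
open import Data.Sum as Sum using (_⊎_; inj₁; inj₂)
open import Data.Unit using (tt)
open import Data.Vec using (Vec; []; _∷_)
import Data.Vec as Vec
open import Function using (_∘_; id)
open import Function.Bundles using (_⇔_; mk⇔; Equivalence)
open import Relation.Binary.Definitions using (DecidableEquality)
open import Relation.Binary.PropositionalEquality using (_≡_; refl; sym; trans; cong; subst)
open import Relation.Nullary using (¬_; Dec; yes; no)

open Equivalence using (to; from)

bounded-max : ExcludedMiddle 0ℓ → (P : ℕ → Set) {n c : ℕ} → P n → (∀ {m} → P m → m ≤ c) →
              ∃ λ d → P d × (∀ {m} → P m → m ≤ d)
bounded-max lem P {c = c} pn bound with lem {P c}
... | yes pc = c , pc , bound
bounded-max lem P {c = zero} pn bound | no ¬pc = ⊥-elim (¬pc (subst P (ℕ.n≤0⇒n≡0 (bound pn)) pn))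
bounded-max lem P {c = suc c} pn bound | no ¬pc =
  bounded-max lem P pn (λ pm → ℕ.≤-pred (ℕ.≤∧≢⇒< (bound pm) (λ m≡c → ¬pc (subst P m≡c pm))))

separation : (ls us : List ℤ) → (∀ {l u} → l ∈ ls → u ∈ us → l ≤ℤ u) →
             ∃ λ v → (∀ {l} → l ∈ ls → l ≤ℤ v) × (∀ {u} → u ∈ us → v ≤ℤ u)
separation [] us _ = Extrema.min 0ℤ us , (λ ()) , All.lookup (Extrema.min≤xs 0ℤ us)
separation (l ∷ ls) us l≤u =
  Extrema.max l ls ,
  All.lookup (Extrema.⊥≤max l ls All.∷ Extrema.xs≤max l ls) ,
  λ u∈ → Extrema.max≤v⁺ (l≤u (here refl) u∈) (All.tabulate λ l′∈ → l≤u (there l′∈) u∈)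

i-j+j≡i : ∀ i j → i - j + j ≡ i
i-j+j≡i = solve-∀

i+j≡i+[j+k]-k : ∀ i j k → i + j ≡ i + (j + k) - k
i+j≡i+[j+k]-k = solve-∀

allPairs⇒trichotomous : ∀ {A : Set} {R : A → A → Set} {xs : List A} → AllPairs R xs →
                        ∀ {x y} → x ∈ xs → y ∈ xs → x ≡ y ⊎ R x y ⊎ R y x
allPairs⇒trichotomous (_  ∷ _)  (here refl) (here refl) = inj₁ refl
allPairs⇒trichotomous (rs ∷ _)  (here refl) (there y∈)  = inj₂ (inj₁ (All.lookup rs y∈))
allPairs⇒trichotomous (rs ∷ _)  (there x∈)  (here refl) = inj₂ (inj₂ (All.lookup rs x∈))
allPairs⇒trichotomous (_  ∷ ps) (there x∈)  (there y∈)  = allPairs⇒trichotomous ps x∈ y∈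

lookup-injective : ∀ {A : Set} {xs : List A} → Unique xs →
                   ∀ {i j} → lookup xs i ≡ lookup xs j → i ≡ j
lookup-injective (_   ∷ _) {Fin.zero}  {Fin.zero}  _ = refl
lookup-injective (x∉ ∷ _) {Fin.zero}  {Fin.suc j} x≡ = ⊥-elim (All.lookup x∉ (∈-lookup j) x≡)
lookup-injective (x∉ ∷ _) {Fin.suc i} {Fin.zero}  ≡x = ⊥-elim (All.lookup x∉ (∈-lookup i) (sym ≡x))
lookup-injective (_   ∷ u) {Fin.suc i} {Fin.suc j} i≡j = cong Fin.suc (lookup-injective u i≡j)

length≤-injectsInto-< : ∀ {A : Set} {xs : List A} {k} (g : A → ℕ) → Unique xs →
                        (∀ {x y} → x ∈ xs → y ∈ xs → g x ≡ g y → x ≡ y) →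
                        (∀ {x} → x ∈ xs → g x < k) → length xs ≤ k
length≤-injectsInto-< {xs = xs} {k} g unique g-inj g< = injective⇒≤ f-injective
  where
  f : Fin (length xs) → Fin k
  f i = fromℕ< (g< (∈-lookup i))

  f-injective : ∀ {i j} → f i ≡ f j → i ≡ j
  f-injective {i} {j} fi≡fj = lookup-injective unique (g-inj (∈-lookup i) (∈-lookup j) g[i]≡g[j])
    where
    g[i]≡g[j] : g (lookup xs i) ≡ g (lookup xs j)
    g[i]≡g[j] = trans (sym (toℕ-fromℕ< _)) (trans (cong toℕ fi≡fj) (toℕ-fromℕ< _))

length≤-injectsInto-interval : ∀ {A : Set} {xs : List A} {lo hi} (g : A → ℤ) → Unique xs →
                               (∀ {x y} → x ∈ xs → y ∈ xs → g x ≡ g y → x ≡ y) →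
                               (∀ {x} → x ∈ xs → lo ≤ℤ g x × g x ≤ℤ hi) →
                               length xs ≤ suc ∣ hi - lo ∣
length≤-injectsInto-interval {A = A} {xs} {lo} {hi} g unique g-inj g∈ =
  length≤-injectsInto-< offset unique offset-inj offset<
  where
  open GroupProperties (AbelianGroup.group ℤ.+-0-abelianGroup) using (∙-cancelʳ)

  offset : A → ℕ
  offset x = ∣ g x - lo ∣

  +offset : ∀ {i} → lo ≤ℤ i → + ∣ i - lo ∣ ≡ i - lo
  +offset lo≤i = ℤ.0≤i⇒+∣i∣≡i (ℤ.i≤j⇒0≤j-i lo≤i)

  offset-inj : ∀ {x y} → x ∈ xs → y ∈ xs → offset x ≡ offset y → x ≡ y
  offset-inj x∈ y∈ ox≡oy = g-inj x∈ y∈ (∙-cancelʳ (- lo) _ _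
    (trans (sym (+offset (proj₁ (g∈ x∈)))) (trans (cong +_ ox≡oy) (+offset (proj₁ (g∈ y∈))))))

  offset< : ∀ {x} → x ∈ xs → offset x < suc ∣ hi - lo ∣
  offset< {x} x∈ = s≤s (ℤ.drop‿+≤+ (begin
    + ∣ g x - lo ∣  ≡⟨ +offset lo≤gx ⟩
    g x - lo        ≤⟨ ℤ.+-monoˡ-≤ (- lo) gx≤hi ⟩
    hi - lo         ≡⟨ +offset (ℤ.≤-trans lo≤gx gx≤hi) ⟨
    + ∣ hi - lo ∣   ∎))
    where
    open ℤ.≤-Reasoning
    lo≤gx : lo ≤ℤ g x
    lo≤gx = proj₁ (g∈ x∈)

    gx≤hi : g x ≤ℤ hi
    gx≤hi = proj₂ (g∈ x∈)

module Graph {σ : Sig} (B : CStr σ) where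

  C : Set
  C = Carrier B

  Edge : Sym → C → C → Set
  Edge R a c = Σ (T (σ R)) λ p → rel B R p a c

  data Step (a c : C) : ℕ → Set where
    ascent : Edge lt a c → Step a c 1
    level  : Edge eq a c ⊎ Edge eq c a → Step a c 0

  infixr 5 _∷_ _++ʷ_

  data Walk : C → C → ℕ → Set where
    []  : ∀ {a} → Walk a a 0
    _∷_ : ∀ {a c b i n} → Step a c i → Walk c b n → Walk a b (i ℕ.+ n)

  _++ʷ_ : ∀ {a b c n m} → Walk a b n → Walk b c m → Walk a c (n ℕ.+ m)
  []             ++ʷ v = v
  (ascent e ∷ w) ++ʷ v = ascent e ∷ (w ++ʷ v)
  (level e  ∷ w) ++ʷ v = level e ∷ (w ++ʷ v)

  Adjacent : C → C → Set
  Adjacent a c = ∃ (Step a c)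

  Reach : C → C → Set
  Reach a b = ∃ (Walk a b)

  Reach⁺ : C → C → Set
  Reach⁺ a b = ∃₂ λ u v → Reach a u × Edge lt u v × Reach v b

  reach-refl : ∀ {a} → Reach a a
  reach-refl = 0 , []

  reach-trans : ∀ {a b c} → Reach a b → Reach b c → Reach a c
  reach-trans (_ , w) (_ , v) = _ , w ++ʷ v

  adjacent⇒reach : ∀ {a c} → Adjacent a c → Reach a c
  adjacent⇒reach (_ , s) = _ , s ∷ []

  reach⁺⇒reach : ∀ {a b} → Reach⁺ a b → Reach a b
  reach⁺⇒reach (_ , _ , r₁ , e , r₂) = reach-trans r₁ (reach-trans (adjacent⇒reach (_ , ascent e)) r₂)

  step-reach⁺ : ∀ {a c b i} → Step a c i → Reach⁺ c b → Reach⁺ a b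
  step-reach⁺ s (u , v , r₁ , e , r₂) = u , v , reach-trans (adjacent⇒reach (_ , s)) r₁ , e , r₂

  weight≡0⊎reach⁺ : ∀ {a b n} → Walk a b n → n ≡ 0 ⊎ Reach⁺ a b
  weight≡0⊎reach⁺ []             = inj₁ refl
  weight≡0⊎reach⁺ (ascent e ∷ w) = inj₂ (_ , _ , reach-refl , e , (_ , w))
  weight≡0⊎reach⁺ (level e  ∷ w) = Sum.map id (step-reach⁺ (level e)) (weight≡0⊎reach⁺ w)

  Acyclic : Set
  Acyclic = ∀ x → ¬ Reach⁺ x x

  WeightBounded : Set
  WeightBounded = ∀ a b → ∃ λ c → ∀ {n} → Walk a b n → n ≤ c

  Chain : C → C → List C → Set
  Chain x y F = (∀ {z} → z ∈ F → Reach x z × Reach z y) ×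
                (∀ {z z′} → z ∈ F → z′ ∈ F → z ≡ z′ ⊎ Reach⁺ z z′ ⊎ Reach⁺ z′ z)

  ChainsBounded : Set
  ChainsBounded = ∀ x y → ∃ λ b → ∀ (F : FinSet C) → Chain x y (proj₁ F) → length (proj₁ F) ≤ b

  IsHom : (C → ℤ) → Set
  IsHom h = ∀ (R : Sym) (p : T (σ R)) x y → rel B R p x y → ZRel R (h x) (h y)

  Potential : (C → ℤ) → Set
  Potential h = ∀ {a b n} → Walk a b n → h a + + n ≤ℤ h b

  module _ {h : C → ℤ} where
    open ℤ.≤-Reasoning

    hom⇒potential : IsHom h → Potential h
    hom⇒potential hom = potential
      where
      step : ∀ {a c i} → Step a c i → h a + + i ≤ℤ h c
      step {a} {c} (ascent (p , e)) = begin
        h a + + 1  ≡⟨ ℤ.+-comm (h a) (+ 1) ⟩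
        sucℤ (h a) ≤⟨ ℤ.i<j⇒suc[i]≤j (hom lt p a c e) ⟩
        h c        ∎
      step (level (inj₁ (p , e))) = ℤ.≤-reflexive (trans (ℤ.+-identityʳ _) (hom eq p _ _ e))
      step (level (inj₂ (p , e))) = ℤ.≤-reflexive (trans (ℤ.+-identityʳ _) (sym (hom eq p _ _ e)))

      potential : Potential h
      potential [] = ℤ.≤-reflexive (ℤ.+-identityʳ _)
      potential {a} {b} (_∷_ {c = c} {i = i} {n = n} s w) = begin
        h a + + (i ℕ.+ n)  ≡⟨ cong (λ k → h a + k) (ℤ.pos-+ i n) ⟩
        h a + (+ i + + n)  ≡⟨ ℤ.+-assoc (h a) (+ i) (+ n) ⟨
        h a + + i + + n    ≤⟨ ℤ.+-monoˡ-≤ (+ n) (step s) ⟩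
        h c + + n          ≤⟨ potential w ⟩
        h b                ∎

    module _ (potential : Potential h) where

      potential-≤ : ∀ {a b} → Reach a b → h a ≤ℤ h b
      potential-≤ (n , w) = ℤ.≤-trans (ℤ.i≤i+j _ (+ n)) (potential w)

      potential⇒hom : IsHom h
      potential⇒hom lt p x y e = ℤ.suc[i]≤j⇒i<j (begin
        sucℤ (h x) ≡⟨ ℤ.+-comm (+ 1) (h x) ⟩
        h x + + 1   ≤⟨ potential (ascent (p , e) ∷ []) ⟩
        h y         ∎)
      potential⇒hom eq p x y e =
        ℤ.≤-antisym (potential-≤ (adjacent⇒reach (_ , level (inj₁ (p , e)))))
                    (potential-≤ (adjacent⇒reach (_ , level (inj₂ (p , e)))))

      potential-< : ∀ {a b} → Reach⁺ a b → h a <ℤ h b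
      potential-< (u , v , r₁ , (p , e) , r₂) =
        ℤ.≤-<-trans (potential-≤ r₁) (ℤ.<-≤-trans (potential⇒hom lt p u v e) (potential-≤ r₂))

      potential⇒acyclic : Acyclic
      potential⇒acyclic x r = ℤ.<-irrefl refl (potential-< r)

      potential⇒chainsBounded : ChainsBounded
      potential⇒chainsBounded x y = suc ∣ h y - h x ∣ , λ (F , unique) (between , comparable) →
        length≤-injectsInto-interval h unique (h-injective comparable)
          (λ z∈ → Product.map potential-≤ potential-≤ (between z∈))
        where
        h-injective : ∀ {F} → (∀ {z z′} → z ∈ F → z′ ∈ F → z ≡ z′ ⊎ Reach⁺ z z′ ⊎ Reach⁺ z′ z) →
                      ∀ {z z′} → z ∈ F → z′ ∈ F → h z ≡ h z′ → z ≡ z′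
        h-injective comparable z∈ z′∈ hz≡hz′ with comparable z∈ z′∈
        ... | inj₁ z≡z′        = z≡z′
        ... | inj₂ (inj₁ z<z′) = ⊥-elim (ℤ.<⇒≢ (potential-< z<z′) hz≡hz′)
        ... | inj₂ (inj₂ z′<z) = ⊥-elim (ℤ.<⇒≢ (potential-< z′<z) (sym hz≡hz′))

  ascents : ∀ {a b n} → Walk a b n → List C
  ascents []                         = []
  ascents (_∷_ {c = c} (ascent _) w) = c ∷ ascents w
  ascents (level _ ∷ w)              = ascents w

  length-ascents : ∀ {a b n} (w : Walk a b n) → length (ascents w) ≡ n
  length-ascents []             = refl
  length-ascents (ascent _ ∷ w) = cong suc (length-ascents w)
  length-ascents (level _  ∷ w) = length-ascents w

  ascents-between : ∀ {a b n} (w : Walk a b n) → ∀ {z} → z ∈ ascents w → Reach⁺ a z × Reach z b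
  ascents-between (ascent e ∷ w) (here refl) = (_ , _ , reach-refl , e , reach-refl) , (_ , w)
  ascents-between (ascent e ∷ w) (there z∈)  = Product.map₁ (step-reach⁺ (ascent e)) (ascents-between w z∈)
  ascents-between (level e  ∷ w) z∈          = Product.map₁ (step-reach⁺ (level e)) (ascents-between w z∈)

  ascents-increasing : ∀ {a b n} (w : Walk a b n) → AllPairs Reach⁺ (ascents w)
  ascents-increasing []             = []
  ascents-increasing (ascent _ ∷ w) = All.tabulate (proj₁ ∘ ascents-between w) ∷ ascents-increasing w
  ascents-increasing (level _  ∷ w) = ascents-increasing w

  chainsBounded⇒weightBounded : Acyclic → ChainsBounded → WeightBounded
  chainsBounded⇒weightBounded acyclic chainsBounded a b =
    let k , bound = chainsBounded a b in
    k , λ w → subst (_≤ k) (length-ascents w) (bound (ascents w , unique w) (chain w))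
    where
    unique : ∀ {n} (w : Walk a b n) → Unique (ascents w)
    unique w = AllPairs.map (λ z<z′ z≡z′ → acyclic _ (subst (Reach⁺ _) (sym z≡z′) z<z′)) (ascents-increasing w)

    chain : ∀ {n} (w : Walk a b n) → Chain a b (ascents w)
    chain w = Product.map₁ reach⁺⇒reach ∘ ascents-between w ,
              allPairs⇒trichotomous (ascents-increasing w)

  vertices : ∀ {a b n} → Walk a b n → List C
  vertices {a} []      = a ∷ []
  vertices {a} (_ ∷ w) = a ∷ vertices w

  start∈vertices : ∀ {a b n} (w : Walk a b n) → a ∈ vertices w
  start∈vertices []      = here refl
  start∈vertices (_ ∷ _) = here refl

  StepClosedIn : List C → List C → Set
  StepClosedIn X Y = ∀ {u v} → u ∈ Y → v ∈ X → Adjacent u v → v ∈ Y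

  walk-stays : ∀ {X Y a b n} → StepClosedIn X Y → (w : Walk a b n) → vertices w ⊆ X → a ∈ Y → b ∈ Y
  walk-stays closed []      _  a∈Y = a∈Y
  walk-stays closed (s ∷ w) w⊆X a∈Y =
    walk-stays closed w (w⊆X ∘ there) (closed a∈Y (w⊆X (there (start∈vertices w))) (_ , s))

module Formulas (σ : Sig) where

  private variable n m : ℕ

  infixr 4 _⇒_

  falsum : Formula σ n m
  falsum = ex1 (neg (eqv (# 0) (# 0)))

  _⇒_ : Formula σ n m → Formula σ n m → Formula σ n m
  φ ⇒ ψ = or (neg φ) ψ

  guarded : (b : Bool) → (T b → Formula σ n m) → Formula σ n m
  guarded true  φ = φ tt
  guarded false _ = falsum

  relF : Sym → Fin n → Fin n → Formula σ n m
  relF R i j = guarded (σ R) λ p → atom R p i j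

  stepF : Fin n → Fin n → Formula σ n m
  stepF i j = or (relF lt i j) (or (relF eq i j) (relF eq j i))

  -- StepClosedIn X Y, with X and Y the set variables 1 and 0
  closedF : Formula σ n (2 ℕ.+ m)
  closedF = all1 (all1 (and (and (mem (# 1) (# 0)) (mem (# 0) (# 1))) (stepF (# 1) (# 0)) ⇒ mem (# 0) (# 0)))

  reachF : Fin n → Fin n → Formula σ n m
  reachF i j = ex2 (and (mem i (# 0)) (all2 (and (mem i (# 0)) closedF ⇒ mem j (# 0))))

  reach⁺F : Fin n → Fin n → Formula σ n m
  reach⁺F i j = ex1 (ex1 (and (reachF (2 ↑ʳ i) (# 1)) (and (relF lt (# 1) (# 0)) (reachF (# 0) (2 ↑ʳ j)))))

  -- Chain x y X, with x and y the variables 1 and 0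
  chainF : Formula σ 2 1
  chainF = and (all1 (mem (# 0) (# 0) ⇒ and (reachF (# 2) (# 0)) (reachF (# 0) (# 1))))
               (all1 (all1 (and (mem (# 1) (# 0)) (mem (# 0) (# 0)) ⇒
                            or (eqv (# 1) (# 0)) (or (reach⁺F (# 1) (# 0)) (reach⁺F (# 0) (# 1))))))

  homSentence : Sentence σ
  homSentence = and (all1 (neg (reach⁺F (# 0) (# 0)))) (all1 (all1 (bnd chainF)))

module Semantics (lem : ExcludedMiddle 0ℓ) {σ : Sig} (B : CStr σ) where
  open Formulas σ
  open Graph B

  private variable n m : ℕ

  ⇒-intro : ∀ {P Q : Set} → (P → Q) → ¬ P ⊎ Q
  ⇒-intro {P} f with lem {P}
  ... | yes p = inj₂ (f p)
  ... | no ¬p = inj₁ ¬p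

  ⇒-elim : ∀ {P Q : Set} → ¬ P ⊎ Q → P → Q
  ⇒-elim (inj₁ ¬p) p = ⊥-elim (¬p p)
  ⇒-elim (inj₂ q)  _ = q

  module _ (ρ : Vec C n) (η : Vec (FinSet C) m) where

    sat-guarded : (b : Bool) (φ : T b → Formula σ n m) → Sat B ρ η (guarded b φ) ⇔ Σ (T b) (Sat B ρ η ∘ φ)
    sat-guarded true  _ = mk⇔ (tt ,_) proj₂
    sat-guarded false _ = mk⇔ (λ (c , c≢c) → ⊥-elim (c≢c refl)) λ ()

    sat-rel : ∀ R i j → Sat B ρ η (relF R i j) ⇔ Edge R (Vec.lookup ρ i) (Vec.lookup ρ j)
    sat-rel R i j = sat-guarded (σ R) _

    sat-step : ∀ i j → Sat B ρ η (stepF i j) ⇔ Adjacent (Vec.lookup ρ i) (Vec.lookup ρ j)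
    sat-step i j = mk⇔
      (λ { (inj₁ e)        → _ , ascent (to (sat-rel lt i j) e)
         ; (inj₂ (inj₁ e)) → _ , level (inj₁ (to (sat-rel eq i j) e))
         ; (inj₂ (inj₂ e)) → _ , level (inj₂ (to (sat-rel eq j i) e)) })
      (λ { (_ , ascent e)        → inj₁ (from (sat-rel lt i j) e)
         ; (_ , level (inj₁ e)) → inj₂ (inj₁ (from (sat-rel eq i j) e))
         ; (_ , level (inj₂ e)) → inj₂ (inj₂ (from (sat-rel eq j i) e)) })

  sat-closed : (ρ : Vec C n) (η : Vec (FinSet C) m) (X Y : FinSet C) →
               Sat B ρ (Y ∷ X ∷ η) closedF ⇔ StepClosedIn (proj₁ X) (proj₁ Y)
  sat-closed ρ η X Y = mk⇔
    (λ closed {u} {v} u∈Y v∈X adj →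
       ⇒-elim (closed u v) ((u∈Y , v∈X) , from (sat-step (v ∷ u ∷ ρ) (Y ∷ X ∷ η) (# 1) (# 0)) adj))
    (λ closed u v → ⇒-intro λ ((u∈Y , v∈X) , s) →
       closed u∈Y v∈X (to (sat-step (v ∷ u ∷ ρ) (Y ∷ X ∷ η) (# 1) (# 0)) s))

  sat-reach : (ρ : Vec C n) (η : Vec (FinSet C) m) (i j : Fin n) →
              Sat B ρ η (reachF i j) ⇔ Reach (Vec.lookup ρ i) (Vec.lookup ρ j)
  sat-reach ρ η i j = mk⇔ reach reachability-witness
    where
    a = Vec.lookup ρ i

    _≟_ : DecidableEquality C
    x ≟ y = lem

    reachable? : (z : C) → Dec (Reach a z)
    reachable? z = lem

    -- the vertices of X reachable from a form a step-closed set containing a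
    reach : Sat B ρ η (reachF i j) → Reach a (Vec.lookup ρ j)
    reach (X , a∈X , least) = proj₂ (∈-filter⁻ reachable? {xs = proj₁ X} (⇒-elim (least Y) (a∈Y , from (sat-closed ρ η X Y) closed)))
      where
      Y : FinSet C
      Y = filter reachable? (proj₁ X) , filter⁺ reachable? (proj₂ X)

      a∈Y : a ∈ proj₁ Y
      a∈Y = ∈-filter⁺ reachable? a∈X reach-refl

      closed : StepClosedIn (proj₁ X) (proj₁ Y)
      closed u∈Y v∈X adj =
        ∈-filter⁺ reachable? v∈X (reach-trans (proj₂ (∈-filter⁻ reachable? {xs = proj₁ X} u∈Y)) (adjacent⇒reach adj))

    reachability-witness : Reach a (Vec.lookup ρ j) → Sat B ρ η (reachF i j)
    reachability-witness (_ , w) =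
      X , ∈-deduplicate⁺ _≟_ (start∈vertices w) ,
      λ Y → ⇒-intro λ (a∈Y , closed) →
        walk-stays (to (sat-closed ρ η X Y) closed) w (∈-deduplicate⁺ _≟_) a∈Y
      where
      X : FinSet C
      X = deduplicate _≟_ (vertices w) , deduplicate-! _≟_ (vertices w)

  sat-reach⁺ : (ρ : Vec C n) (η : Vec (FinSet C) m) (i j : Fin n) →
               Sat B ρ η (reach⁺F i j) ⇔ Reach⁺ (Vec.lookup ρ i) (Vec.lookup ρ j)
  sat-reach⁺ ρ η i j = mk⇔
    (λ (u , v , r₁ , e , r₂) →
      u , v , to (sat-reach (v ∷ u ∷ ρ) η (2 ↑ʳ i) (# 1)) r₁ , to (sat-rel (v ∷ u ∷ ρ) η lt (# 1) (# 0)) e ,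
      to (sat-reach (v ∷ u ∷ ρ) η (# 0) (2 ↑ʳ j)) r₂)
    (λ (u , v , r₁ , e , r₂) →
      u , v , from (sat-reach (v ∷ u ∷ ρ) η (2 ↑ʳ i) (# 1)) r₁ , from (sat-rel (v ∷ u ∷ ρ) η lt (# 1) (# 0)) e ,
      from (sat-reach (v ∷ u ∷ ρ) η (# 0) (2 ↑ʳ j)) r₂)

  sat-chain : ∀ x y (F : FinSet C) → Sat B (y ∷ x ∷ []) (F ∷ []) chainF ⇔ Chain x y (proj₁ F)
  sat-chain x y F = mk⇔
    (λ (between , comparable) →
      (λ {z} z∈ → Product.map (to (sat-reach (env₁ z) (F ∷ []) (# 2) (# 0))) (to (sat-reach (env₁ z) (F ∷ []) (# 0) (# 1)))
                              (⇒-elim (between z) z∈)) ,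
      (λ {z} {z′} z∈ z′∈ → Sum.map₂ (Sum.map (to (sat-reach⁺ (env₂ z z′) (F ∷ []) (# 1) (# 0)))
                                              (to (sat-reach⁺ (env₂ z z′) (F ∷ []) (# 0) (# 1))))
                                    (⇒-elim (comparable z z′) (z∈ , z′∈))))
    (λ (between , comparable) →
      (λ z → ⇒-intro λ z∈ →
        Product.map (from (sat-reach (env₁ z) (F ∷ []) (# 2) (# 0))) (from (sat-reach (env₁ z) (F ∷ []) (# 0) (# 1)))
                    (between z∈)) ,
      (λ z z′ → ⇒-intro λ (z∈ , z′∈) →
        Sum.map₂ (Sum.map (from (sat-reach⁺ (env₂ z z′) (F ∷ []) (# 1) (# 0)))
                          (from (sat-reach⁺ (env₂ z z′) (F ∷ []) (# 0) (# 1))))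
                 (comparable z∈ z′∈)))
    where
    env₁ : C → Vec C 3
    env₁ z = z ∷ y ∷ x ∷ []

    env₂ : C → C → Vec C 4
    env₂ z z′ = z′ ∷ z ∷ y ∷ x ∷ []

  sat-homSentence : B ⊨ homSentence ⇔ (Acyclic × ChainsBounded)
  sat-homSentence = mk⇔
    (Product.map (λ acyclic x → acyclic x ∘ from (sat-reach⁺ (x ∷ []) [] (# 0) (# 0)))
                 (λ bounded x y → Product.map₂ (λ bound F → bound F ∘ from (sat-chain x y F)) (bounded x y)))
    (Product.map (λ acyclic x → acyclic x ∘ to (sat-reach⁺ (x ∷ []) [] (# 0) (# 0)))
                 (λ bounded x y → Product.map₂ (λ bound F → bound F ∘ to (sat-chain x y F)) (bounded x y)))

module Construction (lem : ExcludedMiddle 0ℓ) {σ : Sig} (B : CStr σ)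
                    (acyclic : Graph.Acyclic B) (bounded : Graph.WeightBounded B) where
  open Graph B

  record DominatingWeights (a b : C) : Set where
    field
      weights   : List ℕ
      realised  : ∀ {d} → d ∈ weights → Walk a b d
      dominates : ∀ {n} → Walk a b n → ∃ λ d → d ∈ weights × n ≤ d
  open DominatingWeights

  dominatingWeights : ∀ a b → DominatingWeights a b
  dominatingWeights a b with lem {Reach a b}
  ... | no ¬r = record { weights = [] ; realised = λ () ; dominates = λ w → ⊥-elim (¬r (_ , w)) }
  ... | yes (_ , w) with bounded-max lem (Walk a b) w (proj₂ (bounded a b))
  ...   | d , heaviest , maximal =
    record { weights = d ∷ [] ; realised = λ { (here refl) → heaviest } ; dominates = λ w → d , here refl , maximal w }

  Assignment : Set
  Assignment = List (C × ℤ)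

  Consistent : Assignment → Set
  Consistent L = ∀ {a ha b hb n} → (a , ha) ∈ L → (b , hb) ∈ L → Walk a b n → ha + + n ≤ℤ hb

  module Extension (L : Assignment) (consistent : Consistent L) (x : C) where
    open ℤ.≤-Reasoning

    lowerBounds : List ℤ
    lowerBounds = concatMap (λ (a , ha) → map (λ d → ha + + d) (weights (dominatingWeights a x))) L

    upperBounds : List ℤ
    upperBounds = concatMap (λ (b , hb) → map (λ d → hb - + d) (weights (dominatingWeights x b))) L

    lowerBound-realised : ∀ {l} → l ∈ lowerBounds → ∃₂ λ a ha → ∃ λ d → (a , ha) ∈ L × Walk a x d × l ≡ ha + + d
    lowerBound-realised l∈ with find (∈-concatMap⁻ _ {xs = L} l∈)
    ... | (a , ha) , a∈ , l∈′ with ∈-map⁻ (λ d → ha + + d) l∈′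
    ...   | d , d∈ , refl = a , ha , d , a∈ , realised (dominatingWeights a x) d∈ , refl

    upperBound-realised : ∀ {u} → u ∈ upperBounds → ∃₂ λ b hb → ∃ λ d → (b , hb) ∈ L × Walk x b d × u ≡ hb - + d
    upperBound-realised u∈ with find (∈-concatMap⁻ _ {xs = L} u∈)
    ... | (b , hb) , b∈ , u∈′ with ∈-map⁻ (λ d → hb - + d) u∈′
    ...   | d , d∈ , refl = b , hb , d , b∈ , realised (dominatingWeights x b) d∈ , refl

    lowerBound-dominates : ∀ {a ha n} → (a , ha) ∈ L → Walk a x n → ∃ λ l → l ∈ lowerBounds × ha + + n ≤ℤ l
    lowerBound-dominates {a} {ha} a∈ w =
      let d , d∈ , n≤d = dominates (dominatingWeights a x) w in
      ha + + d , ∈-concatMap⁺ _ (lose a∈ (∈-map⁺ _ d∈)) , ℤ.+-monoʳ-≤ ha (+≤+ n≤d)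

    upperBound-dominates : ∀ {b hb n} → (b , hb) ∈ L → Walk x b n → ∃ λ u → u ∈ upperBounds × u + + n ≤ℤ hb
    upperBound-dominates {b} {hb} {n} b∈ w =
      let d , d∈ , n≤d = dominates (dominatingWeights x b) w in
      hb - + d , ∈-concatMap⁺ _ (lose b∈ (∈-map⁺ _ d∈)) , (begin
        hb - + d + + n  ≤⟨ ℤ.+-monoʳ-≤ (hb - + d) (+≤+ n≤d) ⟩
        hb - + d + + d  ≡⟨ i-j+j≡i hb (+ d) ⟩
        hb              ∎)

    lowerBound≤upperBound : ∀ {l u} → l ∈ lowerBounds → u ∈ upperBounds → l ≤ℤ u
    lowerBound≤upperBound l∈ u∈ with lowerBound-realised l∈ | upperBound-realised u∈
    ... | a , ha , d , a∈ , w , refl | b , hb , d′ , b∈ , w′ , refl = begin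
      ha + + d                   ≡⟨ i+j≡i+[j+k]-k ha (+ d) (+ d′) ⟩
      ha + (+ d + + d′) - + d′   ≡⟨ cong (λ k → ha + k - + d′) (ℤ.pos-+ d d′) ⟨
      ha + + (d ℕ.+ d′) - + d′   ≤⟨ ℤ.+-monoˡ-≤ (- + d′) (consistent a∈ b∈ (w ++ʷ w′)) ⟩
      hb - + d′                  ∎

    separating : ∃ λ v → (∀ {l} → l ∈ lowerBounds → l ≤ℤ v) × (∀ {u} → u ∈ upperBounds → v ≤ℤ u)
    separating = separation lowerBounds upperBounds lowerBound≤upperBound

    value : ℤ
    value = proj₁ separating

    consistent-extension : Consistent ((x , value) ∷ L)
    consistent-extension (here refl) (here refl) w with weight≡0⊎reach⁺ w
    ... | inj₁ refl   = ℤ.≤-reflexive (ℤ.+-identityʳ value)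
    ... | inj₂ cycle  = ⊥-elim (acyclic x cycle)
    consistent-extension (here refl) (there b∈) w =
      let u , u∈ , u+n≤hb = upperBound-dominates b∈ w in
      ℤ.≤-trans (ℤ.+-monoˡ-≤ _ (proj₂ (proj₂ separating) u∈)) u+n≤hb
    consistent-extension (there a∈) (here refl) w =
      let l , l∈ , ha+n≤l = lowerBound-dominates a∈ w in
      ℤ.≤-trans ha+n≤l (proj₁ (proj₂ separating) l∈)
    consistent-extension (there a∈) (there b∈) w = consistent a∈ b∈ w

  ConsistentAssignment : Set
  ConsistentAssignment = Σ Assignment Consistent

  assign : C → ConsistentAssignment → ConsistentAssignment
  assign x (L , consistent) = (x , value) ∷ L , consistent-extension
    where open Extension L consistent x

  assignCode : (k : ℕ) → Dec (∃ λ y → code B y ≡ k) → ConsistentAssignment → ConsistentAssignment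
  assignCode k (yes (y , _)) A = assign y A
  assignCode k (no _)        A = A

  -- stage k has assigned a value to every vertex of code below k
  stage : ℕ → ConsistentAssignment
  stage zero    = [] , λ ()
  stage (suc k) = assignCode k lem (stage k)

  stage-⊆-suc : ∀ k → proj₁ (stage k) ⊆ proj₁ (stage (suc k))
  stage-⊆-suc k = grows lem (stage k)
    where
    grows : ∀ D A → proj₁ A ⊆ proj₁ (assignCode k D A)
    grows (yes _) _ = there
    grows (no _)  _ = id

  stage-mono : ∀ {k k′} → k ≤′ k′ → proj₁ (stage k) ⊆ proj₁ (stage k′)
  stage-mono ≤′-refl        = id
  stage-mono (≤′-step k≤k′) = stage-⊆-suc _ ∘ stage-mono k≤k′

  assigned : ∀ x → ∃ λ v → (x , v) ∈ proj₁ (stage (suc (code B x)))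
  assigned x = assigned-at lem
    where
    assigned-at : ∀ D → ∃ λ v → (x , v) ∈ proj₁ (assignCode (code B x) D (stage (code B x)))
    assigned-at (yes (y , code≡)) with code-inj B y x code≡
    ... | refl = _ , here refl
    assigned-at (no ∄y) = ⊥-elim (∄y (x , refl))

  potential-exists : ∃ Potential
  potential-exists = proj₁ ∘ assigned , λ {a} {b} w →
    proj₂ (stage (suc (code B a ⊔ code B b)))
          (stage-mono (ℕ.≤⇒≤′ (s≤s (ℕ.m≤m⊔n _ _))) (proj₂ (assigned a)))
          (stage-mono (ℕ.≤⇒≤′ (s≤s (ℕ.m≤n⊔m _ _))) (proj₂ (assigned b)))
          w

hom⇔homSentence : ExcludedMiddle 0ℓ → ∀ {σ} (B : CStr σ) → (B ⪯ℤ) ⇔ (B ⊨ Formulas.homSentence σ)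
hom⇔homSentence lem B = mk⇔
  (λ (h , hom) → let potential = hom⇒potential hom in
    from sat-homSentence (potential⇒acyclic potential , potential⇒chainsBounded potential))
  (λ sat → let acyclic , chainsBounded = to sat-homSentence sat
               h , potential = Construction.potential-exists lem B acyclic
                                 (chainsBounded⇒weightBounded acyclic chainsBounded)
           in h , potential⇒hom potential)
  where
  open Graph B
  open Semantics lem B

proposition3 : ExcludedMiddle 0ℓ → EHomDef-WMSOB-ℤ
proposition3 lem = Formulas.homSentence , λ σ B → hom⇔homSentence lem B
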